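{- Let $G$ be an ordered graph with at least one edge. Then $ssat_{<}(n,G)=O(1)$ if and only if all of the following hold: (1) $G$ contains a minedge; (2) $G$ contains an edge connecting the first vertex of $G$ with a vertex of degree one; (3) $G$ contains an edge connecting the last vertex of $G$ with a vertex of degree one. Otherwise $ssat_{<}(n,G)=\Theta(n)$.
   Context: An ordered graph is a finite simple graph whose vertex set is linearly ordered (identified with $[m]$ with the natural order). A copy of $G$ in an ordered graph $H$ is given by an injective order-preserving map $\varphi:V(G)\to V(H)$ with $\varphi(u)\varphi(v)\in E(H)$ for all $uv\in E(G)$. $H$ semisaturates $G$ if for every pair of distinct non-adjacent vertices $x,y$ of $H$, the graph $H+xy$ contains a copy of $G$ that is not contained in $H$ (i.e., a new copy, using the edge $xy$). $ssat_{<}(n,G)$ is the minimum number of edges of an ordered graph on $n$ vertices semisaturating $G$. Edges are written $uv$ with $u<v$; an edge $uv$ of $G$ is a minedge if no vertex lies strictly between $u$ and $v$ and both $u$ and $v$ have degree one. -}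

module Defs where

open import Data.Nat using (ℕ; zero; suc; _+_; _*_; _∸_; _≤_; _<_; _<ᵇ_)
open import Data.Fin using (Fin; toℕ)
open import Data.Bool using (Bool; true; false; if_then_else_; _∧_)
open import Data.List using (List; map; allFin)
open import Data.Nat.ListAction using (sum)
open import Data.Product using (Σ; ∃; ∃-syntax; _×_; _,_)
open import Data.Sum using (_⊎_)
open import Relation.Nullary using (¬_)
open import Relation.Binary.PropositionalEquality using (_≡_; _≢_)

-- An ordered graph on the vertex set [m], identified with Fin m with its
-- natural order; adjacency is symmetric and irreflexive (simple graph).
record OGraph (m : ℕ) : Set where
  field
    adj    : Fin m → Fin m → Bool
    sym    : ∀ i j → adj i j ≡ adj j i
    irrefl : ∀ i → adj i i ≡ false
open OGraph public

Edge : ∀ {m} → OGraph m → Fin m → Fin m → Set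
Edge G i j = adj G i j ≡ true

edges : ∀ {m} → OGraph m → ℕ
edges {m} G = sum (map (λ i → sum (map (λ j →
  if (toℕ i <ᵇ toℕ j) ∧ adj G i j then 1 else 0) (allFin m))) (allFin m))

degree : ∀ {m} → OGraph m → Fin m → ℕ
degree {m} G v = sum (map (λ j → if adj G v j then 1 else 0) (allFin m))

EdgePlus : ∀ {n} → OGraph n → Fin n → Fin n → Fin n → Fin n → Set
EdgePlus H x y i j = Edge H i j ⊎ ((i ≡ x × j ≡ y) ⊎ (i ≡ y × j ≡ x))

IsCopy : ∀ {m n} → OGraph m → (Fin n → Fin n → Set) → (Fin m → Fin n) → Set
IsCopy {m} G E φ =
  (∀ (u v : Fin m) → toℕ u < toℕ v → toℕ (φ u) < toℕ (φ v)) ×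
  (∀ (u v : Fin m) → Edge G u v → E (φ u) (φ v))

Semisat : ∀ {m n} → OGraph n → OGraph m → Set
Semisat {m} {n} H G = ∀ (x y : Fin n) → x ≢ y → ¬ Edge H x y →
  Σ (Fin m → Fin n) λ φ → IsCopy G (EdgePlus H x y) φ × ¬ IsCopy G (Edge H) φ

-- ssat_<(n,G) ≤ k  (unfolding of the minimum)
SsatLE : ∀ {m} → ℕ → OGraph m → ℕ → Set
SsatLE n G k = Σ (OGraph n) λ H → Semisat H G × edges H ≤ k

SsatGE : ∀ {m} → ℕ → OGraph m → ℕ → Set
SsatGE n G k = ∀ (H : OGraph n) → Semisat H G → k ≤ edges H

SsatBounded : ∀ {m} → OGraph m → Set
SsatBounded G = ∃[ C ] (∀ n → SsatLE n G C)

SsatLinear : ∀ {m} → OGraph m → Set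
SsatLinear G = ∃[ c ] ∃[ C ] ∃[ n₀ ] (∀ n → n₀ ≤ n →
  (∀ (H : OGraph n) → Semisat H G → n ≤ c * edges H) × SsatLE n G (C * n))

HasEdge : ∀ {m} → OGraph m → Set
HasEdge G = ∃[ u ] ∃[ v ] Edge G u v

HasMinedge : ∀ {m} → OGraph m → Set
HasMinedge G = ∃[ u ] ∃[ v ]
  (Edge G u v × toℕ v ≡ suc (toℕ u) × degree G u ≡ 1 × degree G v ≡ 1)

FirstToLeaf : ∀ {m} → OGraph m → Set
FirstToLeaf G = ∃[ u ] ∃[ v ] (Edge G u v × toℕ u ≡ 0 × degree G v ≡ 1)

LastToLeaf : ∀ {m} → OGraph m → Set
LastToLeaf {m} G = ∃[ u ] ∃[ v ] (Edge G u v × suc (toℕ u) ≡ m × degree G v ≡ 1)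

-- If one of the three conditions fails, every pair of consecutive vertices of a semisaturating H
-- meets an edge of H.  Indeed, if the pair (or the pair formed with the first or the last vertex)
-- is a non-edge, adding it creates a copy of G in which it is the image of an edge uv of G; the
-- failing condition guarantees that an endpoint of uv has a second neighbour, whose image is then
-- joined to the corresponding vertex of the pair by an old edge of H.  The handshake lemma turns
-- this into n ≤ 5 e(H).
--
-- For the upper bounds, call the first and last K vertices of [n] the blocks.  The band graph, in
-- which block vertices are joined to everything and the other vertices to those at distance less
-- than m, has O(mn) edges and semisaturates every G with an edge: send an innermost edge st of G
-- onto the new pair, the vertices before s into the first block and those after t into the last.
-- When all three conditions hold, the clique on the blocks of size 2m already semisaturates G:
-- according to where the new pair lies, send onto it the edge from the first vertex to a leaf,
-- the edge from the last vertex to a leaf, or the minedge, and everything else into the blocks.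

module Submission where

open import Defs renaming (sym to adj-sym; irrefl to adj-irrefl)
open import Data.Bool using (Bool; true; false; if_then_else_; _∧_)
open import Data.Bool.Properties using (T-≡) renaming (_≟_ to _≟ᵇ_)
open import Data.Fin as Fin using (Fin; toℕ; fromℕ; fromℕ<; inject₁; punchIn; punchOut)
open import Data.Fin.Properties
  using (toℕ<n; toℕ-injective; toℕ-fromℕ; toℕ-fromℕ<; toℕ-inject₁; punchIn-punchOut; punchInᵢ≢i; any?)
  renaming (_≟_ to _≟ᶠ_)
import Data.List as List using (map; allFin; tabulate)
open import Data.List.Properties using (map-tabulate)
open import Data.Nat
open import Data.Nat.Induction using (<-wellFounded)
import Data.Nat.ListAction as List
open import Data.Nat.Properties
open import Data.Nat.Solver using (module +-*-Solver)
open +-*-Solver using (solve; _:+_; _:*_; _:=_; con)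
open import Algebra.Properties.Semiring.Sum +-*-semiring
  using (sum-syntax; ∑-distrib-+; ∑-comm; sum-cong-≗; sum-init-last; sum-remove; *-distribˡ-sum; *-distribʳ-sum)
open import Data.Product using (Σ; ∃; ∃-syntax; _×_; _,_; proj₁; proj₂)
open import Data.Sum using (_⊎_; inj₁; inj₂)
open import Function using (_∘_; id)
open import Function.Bundles using (_⇔_; mk⇔; Equivalence)
open import Induction.WellFounded using (Acc; acc)
open import Relation.Binary.Core using (_Preserves_⟶_)
open import Relation.Binary.Definitions using (tri<; tri≈; tri>)
open import Relation.Binary.PropositionalEquality hiding ([_])
open import Relation.Nullary
open import Relation.Nullary.Decidable using (dec-true; dec-false; does-⇔; _×-dec_; _⊎-dec_; decidable-stable)
open import Relation.Nullary.Reflects using (Reflects; invert)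

∑-const : ∀ n c → ∑[ i < n ] c ≡ n * c
∑-const zero    c = refl
∑-const (suc n) c = cong (c +_) (∑-const n c)

∑-mono-≤ : ∀ {n} {f g : Fin n → ℕ} → (∀ i → f i ≤ g i) → ∑[ i < n ] f i ≤ ∑[ i < n ] g i
∑-mono-≤ {zero}  f≤g = z≤n
∑-mono-≤ {suc n} f≤g = +-mono-≤ (f≤g Fin.zero) (∑-mono-≤ (f≤g ∘ Fin.suc))

term≤∑ : ∀ {n} (f : Fin n → ℕ) i → f i ≤ ∑[ j < n ] f j
term≤∑ f Fin.zero    = m≤m+n _ _
term≤∑ f (Fin.suc i) = ≤-trans (term≤∑ (f ∘ Fin.suc) i) (m≤n+m _ _)

two-terms≤∑ : ∀ {n} (f : Fin (suc n) → ℕ) {i j} → i ≢ j → f i + f j ≤ ∑[ k < suc n ] f k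
two-terms≤∑ {n} f {i} {j} i≢j = begin
  f i + f j                           ≡⟨ cong (λ k → f i + f k) (punchIn-punchOut i≢j) ⟨
  f i + f (punchIn i (punchOut i≢j))  ≤⟨ +-monoʳ-≤ (f i) (term≤∑ (f ∘ punchIn i) (punchOut i≢j)) ⟩
  f i + ∑[ k < n ] f (punchIn i k)    ≡⟨ sum-remove f ⟨
  ∑[ k < suc n ] f k                  ∎
  where open ≤-Reasoning

∑-supported : ∀ {n} (f : Fin (suc n) → ℕ) i → (∀ j → j ≢ i → f j ≡ 0) → ∑[ k < suc n ] f k ≡ f i
∑-supported {n} f i rest = begin
  ∑[ k < suc n ] f k                ≡⟨ sum-remove f ⟩
  f i + ∑[ k < n ] f (punchIn i k)  ≡⟨ cong (f i +_) (sum-cong-≗ {n} (λ k → rest (punchIn i k) (punchInᵢ≢i i k))) ⟩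
  f i + ∑[ k < n ] 0                ≡⟨ cong (f i +_) (trans (∑-const n 0) (*-zeroʳ n)) ⟩
  f i + 0                           ≡⟨ +-identityʳ (f i) ⟩
  f i                               ∎
  where open ≡-Reasoning

sum-allFin : ∀ n (f : Fin n → ℕ) → List.sum (List.map f (List.allFin n)) ≡ ∑[ i < n ] f i
sum-allFin n f = trans (cong List.sum (map-tabulate id f)) (sum-tabulate n f)
  where
  sum-tabulate : ∀ n (f : Fin n → ℕ) → List.sum (List.tabulate f) ≡ ∑[ i < n ] f i
  sum-tabulate zero    f = refl
  sum-tabulate (suc n) f = cong (f Fin.zero +_) (sum-tabulate n (f ∘ Fin.suc))

𝟙 : Bool → ℕ
𝟙 b = if b then 1 else 0

<⇒<ᵇ≡true : ∀ {a b} → a < b → (a <ᵇ b) ≡ true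
<⇒<ᵇ≡true a<b = Equivalence.to T-≡ (<⇒<ᵇ a<b)

Edge? : ∀ {m} (G : OGraph m) i j → Dec (Edge G i j)
Edge? G i j = adj G i j ≟ᵇ true

Edge-sym : ∀ {m} (G : OGraph m) {i j} → Edge G i j → Edge G j i
Edge-sym G {i} {j} e = trans (adj-sym G j i) e

Edge-irrefl : ∀ {m} (G : OGraph m) {i j} → Edge G i j → i ≢ j
Edge-irrefl G {i} e refl with () ← trans (sym e) (adj-irrefl G i)

degree≡∑ : ∀ {m} (G : OGraph m) v → degree G v ≡ ∑[ j < m ] 𝟙 (adj G v j)
degree≡∑ {m} G v = sum-allFin m _

edges≡∑ : ∀ {m} (G : OGraph m) → edges G ≡ ∑[ i < m ] ∑[ j < m ] 𝟙 ((toℕ i <ᵇ toℕ j) ∧ adj G i j)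
edges≡∑ {m} G = trans (sum-allFin m _) (sum-cong-≗ {m} (λ i → sum-allFin m _))

handshake : ∀ {m} (G : OGraph m) → ∑[ v < m ] degree G v ≤ edges G + edges G
handshake {m} G = begin
  ∑[ v < m ] degree G v                    ≡⟨ sum-cong-≗ {m} (degree≡∑ G) ⟩
  ∑[ i < m ] ∑[ j < m ] 𝟙 (adj G i j)      ≤⟨ ∑-mono-≤ (λ i → ∑-mono-≤ (split i)) ⟩
  ∑[ i < m ] ∑[ j < m ] (E i j + E j i)    ≡⟨ sum-cong-≗ {m} (λ i → ∑-distrib-+ (E i) (λ j → E j i)) ⟩
  ∑[ i < m ] (∑[ j < m ] E i j + ∑[ j < m ] E j i)
    ≡⟨ ∑-distrib-+ (λ i → ∑[ j < m ] E i j) (λ i → ∑[ j < m ] E j i) ⟩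
  ∑[ i < m ] ∑[ j < m ] E i j + ∑[ i < m ] ∑[ j < m ] E j i
    ≡⟨ cong (∑[ i < m ] ∑[ j < m ] E i j +_) (∑-comm (λ i j → E j i)) ⟩
  ∑[ i < m ] ∑[ j < m ] E i j + ∑[ j < m ] ∑[ i < m ] E j i
    ≡⟨ cong₂ _+_ (edges≡∑ G) (edges≡∑ G) ⟨
  edges G + edges G                        ∎
  where
  open ≤-Reasoning
  E : Fin m → Fin m → ℕ
  E i j = 𝟙 ((toℕ i <ᵇ toℕ j) ∧ adj G i j)
  split : ∀ i j → 𝟙 (adj G i j) ≤ E i j + E j i
  split i j with <-cmp (toℕ i) (toℕ j)
  ... | tri< i<j _ _ rewrite <⇒<ᵇ≡true i<j = m≤m+n _ _
  ... | tri≈ _ i≡j _ rewrite toℕ-injective i≡j | adj-irrefl G j = z≤n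
  ... | tri> _ _ j<i rewrite <⇒<ᵇ≡true j<i | adj-sym G j i = m≤n+m _ _

degree-pos : ∀ {m} (G : OGraph m) {v w} → Edge G v w → 1 ≤ degree G v
degree-pos {m} G {v} {w} e rewrite degree≡∑ G v =
  subst (λ b → 𝟙 b ≤ ∑[ j < m ] 𝟙 (adj G v j)) e (term≤∑ (𝟙 ∘ adj G v) w)

leaf-neighbour-unique : ∀ {m} (G : OGraph m) {v w w′} →
  degree G v ≡ 1 → Edge G v w → Edge G v w′ → w ≡ w′
leaf-neighbour-unique {suc m} G {v} {w} {w′} deg≡1 e e′ with w ≟ᶠ w′
... | yes w≡w′ = w≡w′
... | no w≢w′ = contradiction (subst (2 ≤_) (trans (sym (degree≡∑ G v)) deg≡1) two≤∑) (<-irrefl refl)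
  where
  two≤∑ : 2 ≤ ∑[ j < suc m ] 𝟙 (adj G v j)
  two≤∑ = subst₂ (λ a b → 𝟙 a + 𝟙 b ≤ ∑[ j < suc m ] 𝟙 (adj G v j)) e e′ (two-terms≤∑ (𝟙 ∘ adj G v) w≢w′)

other-neighbour : ∀ {m} (G : OGraph m) {v u} → Edge G v u → degree G v ≢ 1 →
  ∃[ w ] (Edge G v w × w ≢ u)
other-neighbour {suc m} G {v} {u} e deg≢1 with any? (λ w → Edge? G v w ×-dec ¬? (w ≟ᶠ u))
... | yes found = found
... | no none = contradiction (trans (degree≡∑ G v) (trans (∑-supported (𝟙 ∘ adj G v) u off-u) (cong 𝟙 e)))
                              deg≢1
  where
  off-u : ∀ w → w ≢ u → 𝟙 (adj G v w) ≡ 0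
  off-u w w≢u with adj G v w in vw
  ... | true  = contradiction (w , vw , w≢u) none
  ... | false = refl

StrictlyMonotone : ∀ {m n} → (Fin m → Fin n) → Set
StrictlyMonotone {m} φ = ∀ (u v : Fin m) → toℕ u < toℕ v → toℕ (φ u) < toℕ (φ v)

module _ {m n} {φ : Fin m → Fin n} (mono : StrictlyMonotone φ) where

  strictMono-injective : ∀ {u v} → φ u ≡ φ v → u ≡ v
  strictMono-injective {u} {v} φu≡φv with <-cmp (toℕ u) (toℕ v)
  ... | tri< u<v _ _ = contradiction (cong toℕ φu≡φv) (<⇒≢ (mono u v u<v))
  ... | tri≈ _ u≡v _ = toℕ-injective u≡v
  ... | tri> _ _ v<u = contradiction (cong toℕ (sym φu≡φv)) (<⇒≢ (mono v u v<u))

  strictMono-reflects-< : ∀ {u v} → toℕ (φ u) < toℕ (φ v) → toℕ u < toℕ v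
  strictMono-reflects-< {u} {v} φu<φv with <-cmp (toℕ u) (toℕ v)
  ... | tri< u<v _ _ = u<v
  ... | tri≈ _ u≡v _ = contradiction (cong (toℕ ∘ φ) (toℕ-injective u≡v)) (<⇒≢ φu<φv)
  ... | tri> _ _ v<u = contradiction (mono v u v<u) (<⇒≯ φu<φv)

  strictMono-consecutive : ∀ {u v} → toℕ (φ v) ≡ suc (toℕ (φ u)) → toℕ v ≡ suc (toℕ u)
  strictMono-consecutive {u} {v} φv≡1+φu with <-cmp (toℕ v) (suc (toℕ u))
  ... | tri< v<1+u _ _ = contradiction (strictMono-reflects-< (subst (toℕ (φ u) <_) (sym φv≡1+φu) ≤-refl))
                                       (≤⇒≯ (s≤s⁻¹ v<1+u))
  ... | tri≈ _ v≡1+u _ = v≡1+u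
  ... | tri> _ _ 1+u<v = contradiction (<-≤-trans φu<φw (s≤s⁻¹ (subst (toℕ (φ w) <_) φv≡1+φu φw<φv)))
                                       (<-irrefl refl)
    where
    w : Fin m
    w = fromℕ< (<-trans 1+u<v (toℕ<n v))
    w≡1+u : toℕ w ≡ suc (toℕ u)
    w≡1+u = toℕ-fromℕ< _
    φu<φw : toℕ (φ u) < toℕ (φ w)
    φu<φw = mono u w (subst (toℕ u <_) (sym w≡1+u) ≤-refl)
    φw<φv : toℕ (φ w) < toℕ (φ v)
    φw<φv = mono w v (subst (_< toℕ v) (sym w≡1+u) 1+u<v)

  strictMono-first : ∀ {u} → toℕ (φ u) ≡ 0 → toℕ u ≡ 0
  strictMono-first {Fin.zero}  _      = refl
  strictMono-first {Fin.suc u} φu≡0 =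
    contradiction (subst (toℕ (φ Fin.zero) <_) φu≡0 (mono Fin.zero (Fin.suc u) z<s)) n≮0

  strictMono-last : ∀ {u} → suc (toℕ (φ u)) ≡ n → suc (toℕ u) ≡ m
  strictMono-last {u} 1+φu≡n with <-cmp (suc (toℕ u)) m
  ... | tri< 1+u<m _ _ = contradiction (<-≤-trans (mono u w (subst (toℕ u <_) (sym (toℕ-fromℕ< 1+u<m)) ≤-refl))
                                                  (s≤s⁻¹ (subst (toℕ (φ w) <_) (sym 1+φu≡n) (toℕ<n (φ w)))))
                                       (<-irrefl refl)
    where
    w : Fin m
    w = fromℕ< 1+u<m
  ... | tri≈ _ 1+u≡m _ = 1+u≡m
  ... | tri> _ _ m<1+u = contradiction (toℕ<n u) (≤⇒≯ (s≤s⁻¹ m<1+u))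

EdgePlus-swap : ∀ {n} {H : OGraph n} {x y i j} → EdgePlus H x y i j → EdgePlus H y x i j
EdgePlus-swap (inj₁ e)        = inj₁ e
EdgePlus-swap (inj₂ (inj₁ p)) = inj₂ (inj₂ p)
EdgePlus-swap (inj₂ (inj₂ p)) = inj₂ (inj₁ p)

NewCopy : ∀ {m n} → OGraph m → OGraph n → Fin n → Fin n → Set
NewCopy {m} {n} G H x y = Σ (Fin m → Fin n) λ φ → IsCopy G (EdgePlus H x y) φ × ¬ IsCopy G (Edge H) φ

NewCopy-swap : ∀ {m n} {G : OGraph m} {H : OGraph n} {x y} → NewCopy G H x y → NewCopy G H y x
NewCopy-swap {H = H} (φ , (mono , image) , not-in-H) =
  φ , (mono , λ p q → EdgePlus-swap {H = H} ∘ image p q) , not-in-H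

record NewEdge {m n} (G : OGraph m) (H : OGraph n) (x y : Fin n) : Set where
  field
    φ          : Fin m → Fin n
    monotone   : StrictlyMonotone φ
    edge-image : ∀ p q → Edge G p q → EdgePlus H x y (φ p) (φ q)
    u v        : Fin m
    uv         : Edge G u v
    φu≡x       : φ u ≡ x
    φv≡y       : φ v ≡ y

new-edge : ∀ {m n} (G : OGraph m) (H : OGraph n) → Semisat H G → ∀ {x y} → x ≢ y → ¬ Edge H x y → NewEdge G H x y
new-edge G H sat {x} {y} x≢y ¬xy
  with sat x y x≢y ¬xy
... | φ , (mono , image) , not-in-H
  with any? (λ u → any? (λ v → Edge? G u v ×-dec ¬? (Edge? H (φ u) (φ v))))
... | no none = contradiction (mono , in-H) not-in-H
  where
  in-H : ∀ p q → Edge G p q → Edge H (φ p) (φ q)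
  in-H p q pq with Edge? H (φ p) (φ q)
  ... | yes e = e
  ... | no ¬e = contradiction (p , q , pq , ¬e) none
... | yes (u , v , uv , ¬φuv) with image u v uv
...   | inj₁ φuv                 = contradiction φuv ¬φuv
...   | inj₂ (inj₁ (φu≡x , φv≡y)) = record
  { φ = φ ; monotone = mono ; edge-image = image ; u = u ; v = v ; uv = uv ; φu≡x = φu≡x ; φv≡y = φv≡y }
...   | inj₂ (inj₂ (φu≡y , φv≡x)) = record
  { φ = φ ; monotone = mono ; edge-image = image ; u = v ; v = u ; uv = Edge-sym G uv ; φu≡x = φv≡x ; φv≡y = φu≡y }

module _ {m n} {G : OGraph m} {H : OGraph n} where

  NewEdge-swap : ∀ {x y} → NewEdge G H x y → NewEdge G H y x
  NewEdge-swap E = record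
    { φ = φ ; monotone = monotone ; edge-image = λ p q → EdgePlus-swap {H = H} ∘ edge-image p q
    ; u = v ; v = u ; uv = Edge-sym G uv ; φu≡x = φv≡y ; φv≡y = φu≡x }
    where open NewEdge E

  module _ {x y} (E : NewEdge G H x y) where
    open NewEdge E

    -- A second neighbour w of u is sent to a neighbour of x that H already had.
    new-edge-degree : degree G u ≢ 1 → 1 ≤ degree H x
    new-edge-degree deg≢1 with other-neighbour G uv deg≢1
    ... | w , uw , w≢v with edge-image u w uw
    ...   | inj₁ φuφw              = degree-pos H (subst (λ a → Edge H a (φ w)) φu≡x φuφw)
    ...   | inj₂ (inj₁ (_ , φw≡y)) = contradiction (strictMono-injective monotone (trans φw≡y (sym φv≡y))) w≢v
    ...   | inj₂ (inj₂ (φu≡y , _)) = contradiction (strictMono-injective monotone (trans φu≡y (sym φv≡y)))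
                                                   (Edge-irrefl G uv)

-- The lower bound

HasMinedge? : ∀ {m} (G : OGraph m) → Dec (HasMinedge G)
HasMinedge? G = any? λ u → any? λ v →
  Edge? G u v ×-dec toℕ v ≟ suc (toℕ u) ×-dec degree G u ≟ 1 ×-dec degree G v ≟ 1

FirstToLeaf? : ∀ {m} (G : OGraph m) → Dec (FirstToLeaf G)
FirstToLeaf? G = any? λ u → any? λ v → Edge? G u v ×-dec toℕ u ≟ 0 ×-dec degree G v ≟ 1

LastToLeaf? : ∀ {m} (G : OGraph m) → Dec (LastToLeaf G)
LastToLeaf? {m} G = any? λ u → any? λ v → Edge? G u v ×-dec suc (toℕ u) ≟ m ×-dec degree G v ≟ 1

Conditions : ∀ {m} → OGraph m → Set
Conditions G = HasMinedge G × FirstToLeaf G × LastToLeaf G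

Conditions? : ∀ {m} (G : OGraph m) → Dec (Conditions G)
Conditions? G = HasMinedge? G ×-dec FirstToLeaf? G ×-dec LastToLeaf? G

module _ {m n} (G : OGraph m) (H : OGraph (suc n)) (sat : Semisat H G) where

  no-minedge⇒covered : ¬ HasMinedge G → ∀ z → 1 ≤ degree H (inject₁ z) + degree H (Fin.suc z)
  no-minedge⇒covered ¬minedge z with Edge? H (inject₁ z) (Fin.suc z)
  ... | yes e = ≤-trans (degree-pos H e) (m≤m+n _ _)
  ... | no ¬e with new-edge G H sat z≢1+z ¬e
    where
    z≢1+z : inject₁ z ≢ Fin.suc z
    z≢1+z z≡1+z = 1+n≢n (sym (trans (sym (toℕ-inject₁ z)) (cong toℕ z≡1+z)))
  ... | E with degree G (NewEdge.u E) ≟ 1 | degree G (NewEdge.v E) ≟ 1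
  ...   | yes du | yes dv = contradiction (u , v , uv , consecutive , du , dv) ¬minedge
    where
    open NewEdge E
    consecutive : toℕ v ≡ suc (toℕ u)
    consecutive = strictMono-consecutive monotone
      (trans (cong toℕ φv≡y) (cong suc (trans (sym (toℕ-inject₁ z)) (cong toℕ (sym φu≡x)))))
  ...   | no du | _     = ≤-trans (new-edge-degree E du) (m≤m+n _ _)
  ...   | yes _ | no dv = ≤-trans (new-edge-degree (NewEdge-swap E) dv)
                                  (m≤n+m (degree H (Fin.suc z)) (degree H (inject₁ z)))

  no-first⇒covered : ¬ FirstToLeaf G → ∀ z → 1 ≤ degree H (Fin.suc z)
  no-first⇒covered ¬first z with Edge? H (Fin.suc z) Fin.zero
  ... | yes e = degree-pos H e
  ... | no ¬e with new-edge G H sat (λ ()) ¬e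
  ... | E with degree G (NewEdge.u E) ≟ 1
  ...   | yes du = contradiction (v , u , Edge-sym G uv , strictMono-first monotone (cong toℕ φv≡y) , du) ¬first
    where open NewEdge E
  ...   | no du = new-edge-degree E du

  no-last⇒covered : ¬ LastToLeaf G → ∀ z → 1 ≤ degree H (inject₁ z)
  no-last⇒covered ¬last z with Edge? H (inject₁ z) (fromℕ n)
  ... | yes e = degree-pos H e
  ... | no ¬e with new-edge G H sat z≢last ¬e
    where
    z≢last : inject₁ z ≢ fromℕ n
    z≢last z≡n = <-irrefl (trans (sym (toℕ-inject₁ z)) (trans (cong toℕ z≡n) (toℕ-fromℕ n))) (toℕ<n z)
  ... | E with degree G (NewEdge.u E) ≟ 1
  ...   | yes du = contradiction (v , u , Edge-sym G uv , last , du) ¬last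
    where
    open NewEdge E
    last : suc (toℕ v) ≡ m
    last = strictMono-last monotone (cong suc (trans (cong toℕ φv≡y) (toℕ-fromℕ n)))
  ...   | no du = new-edge-degree E du

  failure⇒covered : ¬ Conditions G → ∀ z → 1 ≤ degree H (inject₁ z) + degree H (Fin.suc z)
  failure⇒covered ¬conditions with HasMinedge? G | FirstToLeaf? G | LastToLeaf? G
  ... | no ¬minedge | _         | _        = no-minedge⇒covered ¬minedge
  ... | yes _       | no ¬first | _        = λ z → ≤-trans (no-first⇒covered ¬first z) (m≤n+m _ (degree H (inject₁ z)))
  ... | yes _       | yes _     | no ¬last = λ z → ≤-trans (no-last⇒covered ¬last z) (m≤m+n _ _)
  ... | yes minedge | yes first | yes last = contradiction (minedge , first , last) ¬conditions

  failure⇒n≤4e : ¬ Conditions G → n ≤ 4 * edges H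
  failure⇒n≤4e ¬conditions = begin
    n                                               ≡⟨ trans (∑-const n 1) (*-identityʳ n) ⟨
    ∑[ z < n ] 1                                    ≤⟨ ∑-mono-≤ (failure⇒covered ¬conditions) ⟩
    ∑[ z < n ] (D (inject₁ z) + D (Fin.suc z))      ≡⟨ ∑-distrib-+ (D ∘ inject₁) (D ∘ Fin.suc) ⟩
    ∑[ z < n ] D (inject₁ z) + ∑[ z < n ] D (Fin.suc z)
      ≤⟨ +-mono-≤ (≤-trans (m≤m+n _ (D (fromℕ n))) (≤-reflexive (sym (sum-init-last D))))
                  (m≤n+m _ (D Fin.zero)) ⟩
    ∑[ v < suc n ] D v + ∑[ v < suc n ] D v         ≤⟨ +-mono-≤ (handshake H) (handshake H) ⟩
    (e + e) + (e + e)                               ≡⟨ solve 1 (λ e → (e :+ e) :+ (e :+ e) := con 4 :* e) refl e ⟩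
    4 * e                                           ∎
    where
    open ≤-Reasoning
    e : ℕ
    e = edges H
    D : Fin (suc n) → ℕ
    D = degree H

semisat-lower-bound : ∀ {m} (G : OGraph m) → ¬ Conditions G →
  ∀ n → 2 ≤ n → (H : OGraph n) → Semisat H G → n ≤ 5 * edges H
semisat-lower-bound G ¬conditions (suc n) (s≤s 1≤n) H sat = +-mono-≤ 1≤e n≤4e
  where
  n≤4e : n ≤ 4 * edges H
  n≤4e = failure⇒n≤4e G H sat ¬conditions
  1≤e : 1 ≤ edges H
  1≤e with edges H | n≤4e
  ... | zero  | n≤0 = contradiction n≤0 (<⇒≱ 1≤n)
  ... | suc _ | _   = s≤s z≤n

[_] : ∀ {A : Set} → Dec A → ℕ
[ a? ] = 𝟙 (does a?)

[]≤1 : ∀ {A : Set} (a? : Dec A) → [ a? ] ≤ 1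
[]≤1 (yes _) = ≤-refl
[]≤1 (no _)  = z≤n

[]-cong : ∀ {A B : Set} → (A → B) → (B → A) → (a? : Dec A) (b? : Dec B) → [ a? ] ≡ [ b? ]
[]-cong A→B B→A a? b? = cong 𝟙 (does-⇔ (mk⇔ A→B B→A) a? b?)

[]-≤-⊎ : ∀ {A B C : Set} → (A → B ⊎ C) → (a? : Dec A) (b? : Dec B) (c? : Dec C) → [ a? ] ≤ [ b? ] + [ c? ]
[]-≤-⊎ split (no _)  b?      c?      = z≤n
[]-≤-⊎ split (yes a) (yes _) c?      = s≤s z≤n
[]-≤-⊎ split (yes a) (no ¬b) (yes _) = s≤s z≤n
[]-≤-⊎ split (yes a) (no ¬b) (no ¬c) with split a
... | inj₁ b = contradiction b ¬b
... | inj₂ c = contradiction c ¬c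

[]-≤-× : ∀ {A B C : Set} → (A → B × C) → (a? : Dec A) (b? : Dec B) (c? : Dec C) → [ a? ] ≤ [ b? ] * [ c? ]
[]-≤-× pair (no _)  b?      c?      = z≤n
[]-≤-× pair (yes a) (yes _) (yes _) = s≤s z≤n
[]-≤-× pair (yes a) (no ¬b) c?      = contradiction (proj₁ (pair a)) ¬b
[]-≤-× pair (yes a) (yes _) (no ¬c) = contradiction (proj₂ (pair a)) ¬c

count-below : ∀ n K → ∑[ j < n ] [ toℕ j <? K ] ≤ K
count-below zero    K       = z≤n
count-below (suc n) zero    = ≤-reflexive (trans (∑-const n 0) (*-zeroʳ n))
count-below (suc n) (suc K) = s≤s (count-below n K)

count-above : ∀ n T → ∑[ j < n ] [ T ≤? toℕ j ] ≤ n ∸ T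
count-above n       zero    =
  ≤-trans (∑-mono-≤ {n} (λ j → []≤1 (0 ≤? toℕ j))) (≤-reflexive (trans (∑-const n 1) (*-identityʳ n)))
count-above zero    (suc T) = z≤n
count-above (suc n) (suc T) = ≤-trans (≤-reflexive (sum-cong-≗ {n} shift)) (count-above n T)
  where
  shift : ∀ j → [ suc T ≤? suc (toℕ j) ] ≡ [ T ≤? toℕ j ]
  shift j = []-cong s≤s⁻¹ s≤s (suc T ≤? suc (toℕ j)) (T ≤? toℕ j)

Short : ℕ → ℕ → ℕ → Set
Short L a b = a < b × b < a + L

Short? : ∀ L a b → Dec (Short L a b)
Short? L a b = a <? b ×-dec b <? a + L

count-short : ∀ n L a → ∑[ j < n ] [ Short? L a (toℕ j) ] ≤ L
count-short zero    L       a       = z≤n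
count-short (suc n) zero    zero    = ≤-reflexive (trans (∑-const n 0) (*-zeroʳ n))
count-short (suc n) (suc L) zero    = ≤-trans (count-below n L) (n≤1+n L)
count-short (suc n) L       (suc a) = count-short n L a

-- Placements

jump : ℕ → ℕ → (ℕ → ℕ) → ℕ → ℕ
jump k a h w with w <? k
... | yes _ = a
... | no _  = h w

jump-below : ∀ {k a h w} → w < k → jump k a h w ≡ a
jump-below {k} {w = w} w<k with w <? k
... | yes _  = refl
... | no w≮k = contradiction w<k w≮k

jump-above : ∀ {k a h w} → k ≤ w → jump k a h w ≡ h w
jump-above {k} {w = w} k≤w with w <? k
... | yes w<k = contradiction w<k (≤⇒≯ k≤w)
... | no _    = refl

jump-monotone : ∀ {k a h} → (∀ w → a ≤ h w) → h Preserves _≤_ ⟶ _≤_ → jump k a h Preserves _≤_ ⟶ _≤_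
jump-monotone {k} a≤h h-mono {u} {v} u≤v with u <? k | v <? k
... | yes _  | yes _   = ≤-refl
... | yes _  | no _    = a≤h v
... | no u≮k | yes v<k = contradiction (≤-<-trans u≤v v<k) u≮k
... | no _   | no _    = h-mono u≤v

jump-≥ : ∀ {k a h b} → b ≤ a → (∀ w → b ≤ h w) → ∀ w → b ≤ jump k a h w
jump-≥ {k} b≤a b≤h w with w <? k
... | yes _ = b≤a
... | no _  = b≤h w

record Placement {m n} (s t : Fin m) (x y : Fin n) : Set where
  field
    k        : ℕ
    s<k      : toℕ s < k
    k≤t      : k ≤ toℕ t
    m≤n      : m ≤ n
    s≤x      : toℕ s ≤ toℕ x
    gap      : toℕ x + (toℕ t ∸ toℕ s) ≤ toℕ y
    y≤n∸m+t  : toℕ y ≤ n ∸ m + toℕ t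

  -- The offset is 0 below s, x ∸ s on [s, k), y ∸ t on [k, t] and n ∸ m above t: the vertices
  -- strictly between s and t follow x when k = t and follow y when k = suc s.
  offset : ℕ → ℕ
  offset = jump (toℕ s) 0 (jump k (toℕ x ∸ toℕ s) (jump (suc (toℕ t)) (toℕ y ∸ toℕ t) (λ _ → n ∸ m)))

  place : ℕ → ℕ
  place w = w + offset w

module _ {m n} {s t : Fin m} {x y : Fin n} (π : Placement s t x y) where
  open Placement π

  place-below : ∀ {w} → w < toℕ s → place w ≡ w
  place-below {w} w<s = trans (cong (w +_) (jump-below w<s)) (+-identityʳ w)

  place-left : ∀ {w} → toℕ s ≤ w → w < k → place w ≡ w + (toℕ x ∸ toℕ s)
  place-left {w} s≤w w<k = cong (w +_) (trans (jump-above s≤w) (jump-below w<k))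

  place-right : ∀ {w} → k ≤ w → w ≤ toℕ t → place w ≡ w + (toℕ y ∸ toℕ t)
  place-right {w} k≤w w≤t =
    cong (w +_) (trans (jump-above (<⇒≤ (<-≤-trans s<k k≤w))) (trans (jump-above k≤w) (jump-below (s≤s w≤t))))

  place-above : ∀ {w} → toℕ t < w → place w ≡ w + (n ∸ m)
  place-above {w} t<w = cong (w +_) (trans (jump-above s≤w) (trans (jump-above k≤w) (jump-above t<w)))
    where
    k≤w : k ≤ w
    k≤w = <⇒≤ (≤-<-trans k≤t t<w)
    s≤w : toℕ s ≤ w
    s≤w = <⇒≤ (<-≤-trans s<k k≤w)

  private
    s≤t : toℕ s ≤ toℕ t
    s≤t = <⇒≤ (<-≤-trans s<k k≤t)

    t≤y : toℕ t ≤ toℕ y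
    t≤y = begin
      toℕ t                       ≡⟨ m+[n∸m]≡n s≤t ⟨
      toℕ s + (toℕ t ∸ toℕ s)     ≤⟨ +-monoˡ-≤ _ s≤x ⟩
      toℕ x + (toℕ t ∸ toℕ s)     ≤⟨ gap ⟩
      toℕ y                       ∎
      where open ≤-Reasoning

    x∸s≤y∸t : toℕ x ∸ toℕ s ≤ toℕ y ∸ toℕ t
    x∸s≤y∸t = m+n≤o⇒m≤o∸n (toℕ x ∸ toℕ s) (begin
      toℕ x ∸ toℕ s + toℕ t                       ≡⟨ cong (toℕ x ∸ toℕ s +_) (m+[n∸m]≡n s≤t) ⟨
      toℕ x ∸ toℕ s + (toℕ s + (toℕ t ∸ toℕ s))   ≡⟨ +-assoc (toℕ x ∸ toℕ s) (toℕ s) _ ⟨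
      toℕ x ∸ toℕ s + toℕ s + (toℕ t ∸ toℕ s)     ≡⟨ cong (_+ (toℕ t ∸ toℕ s)) (m∸n+n≡m s≤x) ⟩
      toℕ x + (toℕ t ∸ toℕ s)                     ≤⟨ gap ⟩
      toℕ y                                       ∎)
      where open ≤-Reasoning

    y∸t≤n∸m : toℕ y ∸ toℕ t ≤ n ∸ m
    y∸t≤n∸m = m≤n+o⇒m∸n≤o (toℕ y) (toℕ t) (subst (toℕ y ≤_) (+-comm (n ∸ m) (toℕ t)) y≤n∸m+t)

  offset-monotone : offset Preserves _≤_ ⟶ _≤_
  offset-monotone =
    jump-monotone {k = toℕ s} (λ _ → z≤n)
      (jump-monotone {k = k} (jump-≥ {k = suc (toℕ t)} x∸s≤y∸t (λ _ → ≤-trans x∸s≤y∸t y∸t≤n∸m))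
        (jump-monotone {k = suc (toℕ t)} (λ _ → y∸t≤n∸m) (λ _ → ≤-refl)))

  place-strictMono : place Preserves _<_ ⟶ _<_
  place-strictMono u<v = +-mono-<-≤ u<v (offset-monotone (<⇒≤ u<v))

  place<n : ∀ {w} → w < m → place w < n
  place<n {w} w<m = begin-strict
    w + offset w                  ≤⟨ +-monoʳ-≤ w (offset-monotone (m≤n+m w (suc (toℕ t)))) ⟩
    w + offset (suc (toℕ t) + w)  ≡⟨ cong (w +_) (+-cancelˡ-≡ _ _ _ (place-above (m≤m+n (suc (toℕ t)) w))) ⟩
    w + (n ∸ m)                   <⟨ +-monoˡ-< (n ∸ m) w<m ⟩
    m + (n ∸ m)                   ≡⟨ m+[n∸m]≡n m≤n ⟩
    n                             ∎
    where open ≤-Reasoning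

  place-s : place (toℕ s) ≡ toℕ x
  place-s = trans (place-left ≤-refl s<k) (m+[n∸m]≡n s≤x)

  place-t : place (toℕ t) ≡ toℕ y
  place-t = trans (place-right k≤t ≤-refl) (m+[n∸m]≡n t≤y)

module RelationGraph (n : ℕ) {R : ℕ → ℕ → Set} (R? : ∀ a b → Dec (R a b)) (R-sym : ∀ {a b} → R a b → R b a)
  where

  Adjacent : ℕ → ℕ → Set
  Adjacent a b = a ≢ b × R a b

  Adjacent? : ∀ a b → Dec (Adjacent a b)
  Adjacent? a b = ¬? (a ≟ b) ×-dec R? a b

  graph : OGraph n
  graph = record
    { adj    = λ i j → does (Adjacent? (toℕ i) (toℕ j))
    ; sym    = λ i j → does-⇔ (mk⇔ swap swap) (Adjacent? (toℕ i) (toℕ j)) (Adjacent? (toℕ j) (toℕ i))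
    ; irrefl = λ i → dec-false (Adjacent? (toℕ i) (toℕ i)) (λ (a≢a , _) → a≢a refl) }
    where
    swap : ∀ {a b} → Adjacent a b → Adjacent b a
    swap (a≢b , Rab) = a≢b ∘ sym , R-sym Rab

  adjacent⇒edge : ∀ {i j} → Adjacent (toℕ i) (toℕ j) → Edge graph i j
  adjacent⇒edge {i} {j} = dec-true (Adjacent? (toℕ i) (toℕ j))

  edge⇒adjacent : ∀ {i j} → Edge graph i j → Adjacent (toℕ i) (toℕ j)
  edge⇒adjacent {i} {j} e = invert (subst (Reflects _) e (proof (Adjacent? (toℕ i) (toℕ j))))

  semisat-from-< : ∀ {m} (G : OGraph m) →
    (∀ x y → toℕ x < toℕ y → ¬ R (toℕ x) (toℕ y) → NewCopy G graph x y) → Semisat graph G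
  semisat-from-< G copy x y x≢y ¬xy with <-cmp (toℕ x) (toℕ y)
  ... | tri< x<y _ _ = copy x y x<y (¬xy ∘ adjacent⇒edge ∘ (x≢y ∘ toℕ-injective ,_))
  ... | tri≈ _ x≡y _ = contradiction (toℕ-injective x≡y) x≢y
  ... | tri> _ _ y<x = NewCopy-swap {G = G} {H = graph}
    (copy y x y<x (¬xy ∘ Edge-sym graph ∘ adjacent⇒edge ∘ (x≢y ∘ sym ∘ toℕ-injective ,_)))

  copy-along : ∀ {m} (G : OGraph m) {x y : Fin n} {s t : Fin m} (f : ℕ → ℕ) →
    f Preserves _<_ ⟶ _<_ → (∀ {w} → w < m → f w < n) →
    f (toℕ s) ≡ toℕ x → f (toℕ t) ≡ toℕ y → Edge G s t → ¬ R (toℕ x) (toℕ y) →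
    (∀ p q → Edge G p q → toℕ p < toℕ q → ¬ (p ≡ s × q ≡ t) → R (f (toℕ p)) (f (toℕ q))) →
    NewCopy G graph x y
  copy-along {m} G {x} {y} {s} {t} f f-mono f<n fs≡x ft≡y st ¬Rxy other =
    φ , (φ-mono , image) , λ (_ , in-H) → ¬Rxy (proj₂ (edge⇒adjacent (subst₂ (Edge graph) φs≡x φt≡y (in-H s t st))))
    where
    φ : Fin m → Fin n
    φ w = fromℕ< (f<n (toℕ<n w))
    toℕ-φ : ∀ w → toℕ (φ w) ≡ f (toℕ w)
    toℕ-φ w = toℕ-fromℕ< (f<n (toℕ<n w))
    φ-mono : StrictlyMonotone φ
    φ-mono u v u<v = subst₂ _<_ (sym (toℕ-φ u)) (sym (toℕ-φ v)) (f-mono u<v)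
    φs≡x : φ s ≡ x
    φs≡x = toℕ-injective (trans (toℕ-φ s) fs≡x)
    φt≡y : φ t ≡ y
    φt≡y = toℕ-injective (trans (toℕ-φ t) ft≡y)
    edge-of : ∀ {p q} → toℕ p < toℕ q → R (f (toℕ p)) (f (toℕ q)) → Edge graph (φ p) (φ q)
    edge-of {p} {q} p<q r = adjacent⇒edge (subst₂ Adjacent (sym (toℕ-φ p)) (sym (toℕ-φ q)) (<⇒≢ (f-mono p<q) , r))
    image : ∀ p q → Edge G p q → EdgePlus graph x y (φ p) (φ q)
    image p q pq with p ≟ᶠ s ×-dec q ≟ᶠ t | p ≟ᶠ t ×-dec q ≟ᶠ s
    ... | yes (refl , refl) | _                  = inj₂ (inj₁ (φs≡x , φt≡y))
    ... | no _              | yes (refl , refl)  = inj₂ (inj₂ (φt≡y , φs≡x))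
    ... | no ¬st            | no ¬ts with <-cmp (toℕ p) (toℕ q)
    ...   | tri< p<q _ _ = inj₁ (edge-of p<q (other p q pq p<q ¬st))
    ...   | tri≈ _ p≡q _ = contradiction (toℕ-injective p≡q) (Edge-irrefl G pq)
    ...   | tri> _ _ q<p =
      inj₁ (Edge-sym graph (edge-of q<p (other q p (Edge-sym G pq) q<p (λ (q≡s , p≡t) → ¬ts (p≡t , q≡s)))))

  copy-by-placement : ∀ {m} (G : OGraph m) {x y : Fin n} {s t : Fin m} (π : Placement s t x y) →
    Edge G s t → ¬ R (toℕ x) (toℕ y) →
    (∀ p q → Edge G p q → toℕ p < toℕ q → ¬ (p ≡ s × q ≡ t) →
       R (Placement.place π (toℕ p)) (Placement.place π (toℕ q))) →
    NewCopy G graph x y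
  copy-by-placement G π = copy-along G (Placement.place π) (place-strictMono π) (place<n π) (place-s π) (place-t π)

InBlock : ℕ → ℕ → ℕ → Set
InBlock n K a = a < K ⊎ n ∸ K ≤ a

InBlock? : ∀ n K a → Dec (InBlock n K a)
InBlock? n K a = a <? K ⊎-dec n ∸ K ≤? a

¬InBlock : ∀ {n K a} → ¬ InBlock n K a → K ≤ a × a < n ∸ K
¬InBlock ¬block = ≮⇒≥ (¬block ∘ inj₁) , ≰⇒> (¬block ∘ inj₂)

count-block : ∀ n K → ∑[ j < n ] [ InBlock? n K (toℕ j) ] ≤ K + K
count-block n K = begin
  ∑[ j < n ] [ InBlock? n K (toℕ j) ]
    ≤⟨ ∑-mono-≤ {n} (λ j → []-≤-⊎ id (InBlock? n K (toℕ j)) (toℕ j <? K) (n ∸ K ≤? toℕ j)) ⟩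
  ∑[ j < n ] ([ toℕ j <? K ] + [ n ∸ K ≤? toℕ j ])
    ≡⟨ ∑-distrib-+ {n} (λ j → [ toℕ j <? K ]) (λ j → [ n ∸ K ≤? toℕ j ]) ⟩
  ∑[ j < n ] [ toℕ j <? K ] + ∑[ j < n ] [ n ∸ K ≤? toℕ j ]
    ≤⟨ +-mono-≤ (count-below n K) (count-above n (n ∸ K)) ⟩
  K + (n ∸ (n ∸ K))                                           ≤⟨ +-monoʳ-≤ K n∸[n∸K]≤K ⟩
  K + K                                                       ∎
  where
  open ≤-Reasoning
  n∸[n∸K]≤K : n ∸ (n ∸ K) ≤ K
  n∸[n∸K]≤K with ≤-total K n
  ... | inj₁ K≤n = ≤-reflexive (m∸[m∸n]≡n K≤n)
  ... | inj₂ n≤K = ≤-trans (m∸n≤m n (n ∸ K)) n≤K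

-- The band graph

Near : ℕ → ℕ → ℕ → Set
Near K a b = a < b + K × b < a + K

Linked : ℕ → ℕ → ℕ → ℕ → Set
Linked n K a b = InBlock n K a ⊎ (InBlock n K b ⊎ Near K a b)

Linked? : ∀ n K a b → Dec (Linked n K a b)
Linked? n K a b = InBlock? n K a ⊎-dec InBlock? n K b ⊎-dec (a <? b + K ×-dec b <? a + K)

Linked-sym : ∀ {n K a b} → Linked n K a b → Linked n K b a
Linked-sym (inj₁ a∈B)                 = inj₂ (inj₁ a∈B)
Linked-sym (inj₂ (inj₁ b∈B))          = inj₁ b∈B
Linked-sym (inj₂ (inj₂ (a<b+K , b<a+K))) = inj₂ (inj₂ (b<a+K , a<b+K))

module Band (n K : ℕ) = RelationGraph n (Linked? n K) Linked-sym

band : ∀ n K → OGraph n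
band n K = Band.graph n K

band-edges : ∀ n K → edges (band n K) ≤ 5 * K * n
band-edges n K = begin
  edges (band n K)                                  ≡⟨ edges≡∑ (band n K) ⟩
  ∑[ i < n ] ∑[ j < n ] [ toℕ i <? toℕ j ×-dec Adjacent? (toℕ i) (toℕ j) ]
    ≤⟨ ∑-mono-≤ {n} (λ i → ∑-mono-≤ {n} (λ j → split (toℕ i) (toℕ j))) ⟩
  ∑[ i < n ] ∑[ j < n ] (B i + (B j + S i j))       ≡⟨ sum-cong-≗ {n} regroup ⟩
  ∑[ i < n ] (n * B i + (∑[ j < n ] B j + ∑[ j < n ] S i j))
    ≤⟨ ∑-mono-≤ {n} (λ i → +-monoʳ-≤ (n * B i) (+-mono-≤ (count-block n K) (count-short n K (toℕ i)))) ⟩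
  ∑[ i < n ] (n * B i + (K + K + K))                ≡⟨ ∑-distrib-+ {n} (λ i → n * B i) (λ _ → K + K + K) ⟩
  ∑[ i < n ] (n * B i) + ∑[ i < n ] (K + K + K)
    ≡⟨ cong₂ _+_ (sym (*-distribˡ-sum n B)) (∑-const n (K + K + K)) ⟩
  n * ∑[ i < n ] B i + n * (K + K + K)              ≤⟨ +-monoˡ-≤ _ (*-monoʳ-≤ n (count-block n K)) ⟩
  n * (K + K) + n * (K + K + K)
    ≡⟨ solve 2 (λ n K → n :* (K :+ K) :+ n :* (K :+ K :+ K) := con 5 :* K :* n) refl n K ⟩
  5 * K * n                                         ∎
  where
  open ≤-Reasoning
  open Band n K using (Adjacent; Adjacent?)
  B : Fin n → ℕ
  B i = [ InBlock? n K (toℕ i) ]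
  S : Fin n → Fin n → ℕ
  S i j = [ Short? K (toℕ i) (toℕ j) ]
  split : ∀ a b → [ a <? b ×-dec Adjacent? a b ] ≤ [ InBlock? n K a ] + ([ InBlock? n K b ] + [ Short? K a b ])
  split a b = begin
    [ a <? b ×-dec Adjacent? a b ]
      ≤⟨ []-≤-⊎ classify (a <? b ×-dec Adjacent? a b) (InBlock? n K a) (InBlock? n K b ⊎-dec Short? K a b) ⟩
    [ InBlock? n K a ] + [ InBlock? n K b ⊎-dec Short? K a b ]
      ≤⟨ +-monoʳ-≤ [ InBlock? n K a ]
                   ([]-≤-⊎ id (InBlock? n K b ⊎-dec Short? K a b) (InBlock? n K b) (Short? K a b)) ⟩
    [ InBlock? n K a ] + ([ InBlock? n K b ] + [ Short? K a b ])  ∎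
    where
    classify : a < b × Adjacent a b → InBlock n K a ⊎ (InBlock n K b ⊎ Short K a b)
    classify (_   , _ , inj₁ a∈B)                = inj₁ a∈B
    classify (_   , _ , inj₂ (inj₁ b∈B))         = inj₂ (inj₁ b∈B)
    classify (a<b , _ , inj₂ (inj₂ (_ , b<a+K))) = inj₂ (inj₂ (a<b , b<a+K))
  regroup : ∀ i → ∑[ j < n ] (B i + (B j + S i j)) ≡ n * B i + (∑[ j < n ] B j + ∑[ j < n ] S i j)
  regroup i = begin-equality
    ∑[ j < n ] (B i + (B j + S i j))                ≡⟨ ∑-distrib-+ {n} (λ _ → B i) (λ j → B j + S i j) ⟩
    ∑[ j < n ] B i + ∑[ j < n ] (B j + S i j)       ≡⟨ cong₂ _+_ (∑-const n (B i)) (∑-distrib-+ B (S i)) ⟩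
    n * B i + (∑[ j < n ] B j + ∑[ j < n ] S i j)   ∎

Innermost : ∀ {m} → OGraph m → Fin m → Fin m → Set
Innermost G s t = ∀ p q → Edge G p q → toℕ s ≤ toℕ p → toℕ p < toℕ q → toℕ q ≤ toℕ t → p ≡ s × q ≡ t

nested-shorter : ∀ {m} {s t p q : Fin m} → toℕ s ≤ toℕ p → toℕ p < toℕ q → toℕ q ≤ toℕ t →
  ¬ (p ≡ s × q ≡ t) → toℕ q ∸ toℕ p < toℕ t ∸ toℕ s
nested-shorter {s = s} {t} {p} {q} s≤p p<q q≤t ¬st with m≤n⇒m<n∨m≡n s≤p | m≤n⇒m<n∨m≡n q≤t
... | inj₁ s<p | _        = ≤-<-trans (∸-monoˡ-≤ (toℕ p) q≤t) (∸-monoʳ-< s<p (≤-trans (<⇒≤ p<q) q≤t))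
... | inj₂ s≡p | inj₁ q<t = <-≤-trans (∸-monoˡ-< q<t (<⇒≤ p<q)) (∸-monoʳ-≤ (toℕ t) s≤p)
... | inj₂ s≡p | inj₂ q≡t = contradiction (toℕ-injective (sym s≡p) , toℕ-injective q≡t) ¬st

module _ {m} (G : OGraph m) where

  InnermostEdge : Set
  InnermostEdge = ∃[ s ] ∃[ t ] (Edge G s t × toℕ s < toℕ t × Innermost G s t)

  shrink : ∀ s t → Edge G s t → toℕ s < toℕ t → Acc _<_ (toℕ t ∸ toℕ s) → InnermostEdge
  shrink s t st s<t (acc shorter)
    with any? (λ p → any? (λ q → Edge? G p q ×-dec toℕ s ≤? toℕ p ×-dec toℕ p <? toℕ q ×-dec toℕ q ≤? toℕ t
                                  ×-dec ¬? (p ≟ᶠ s ×-dec q ≟ᶠ t)))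
  ... | yes (p , q , pq , s≤p , p<q , q≤t , ¬st) = shrink p q pq p<q (shorter (nested-shorter s≤p p<q q≤t ¬st))
  ... | no none = s , t , st , s<t , λ p q pq s≤p p<q q≤t →
    decidable-stable (p ≟ᶠ s ×-dec q ≟ᶠ t) (λ ¬st → none (p , q , pq , s≤p , p<q , q≤t , ¬st))

  innermost-edge : HasEdge G → InnermostEdge
  innermost-edge (u , v , uv) with <-cmp (toℕ u) (toℕ v)
  ... | tri< u<v _ _ = shrink u v uv u<v (<-wellFounded _)
  ... | tri≈ _ u≡v _ = contradiction (toℕ-injective u≡v) (Edge-irrefl G uv)
  ... | tri> _ _ v<u = shrink v u (Edge-sym G uv) v<u (<-wellFounded _)

band-semisat : ∀ {m} (G : OGraph m) → HasEdge G → ∀ n → Semisat (band n m) G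
band-semisat {m} G has-edge n with innermost-edge G has-edge
... | s , t , st , s<t , innermost = semisat-from-< G copy
  where
  open Band n m
  copy : ∀ x y → toℕ x < toℕ y → ¬ Linked n m (toℕ x) (toℕ y) → NewCopy G (band n m) x y
  copy x y x<y ¬linked = copy-by-placement G π st ¬linked other
    where
    x-free : m ≤ toℕ x × toℕ x < n ∸ m
    x-free = ¬InBlock (¬linked ∘ inj₁)
    y-free : m ≤ toℕ y × toℕ y < n ∸ m
    y-free = ¬InBlock (¬linked ∘ inj₂ ∘ inj₁)
    x+m≤y : toℕ x + m ≤ toℕ y
    x+m≤y = ≮⇒≥ λ y<x+m → ¬linked (inj₂ (inj₂ (<-≤-trans x<y (m≤m+n (toℕ y) m) , y<x+m)))
    π : Placement s t x y
    π = record
      { k = toℕ t ; s<k = s<t ; k≤t = ≤-refl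
      ; m≤n = ≤-trans (proj₁ x-free) (<⇒≤ (toℕ<n x))
      ; s≤x = ≤-trans (<⇒≤ (toℕ<n s)) (proj₁ x-free)
      ; gap = ≤-trans (+-monoʳ-≤ (toℕ x) (≤-trans (m∸n≤m (toℕ t) (toℕ s)) (<⇒≤ (toℕ<n t)))) x+m≤y
      ; y≤n∸m+t = ≤-trans (<⇒≤ (proj₂ y-free)) (m≤m+n (n ∸ m) (toℕ t)) }
    other : ∀ p q → Edge G p q → toℕ p < toℕ q → ¬ (p ≡ s × q ≡ t) →
      Linked n m (Placement.place π (toℕ p)) (Placement.place π (toℕ q))
    other p q pq p<q ¬st with toℕ s ≤? toℕ p | toℕ q ≤? toℕ t
    ... | no s≰p  | _       = inj₁ (inj₁ (subst (_< m) (sym (place-below π (≰⇒> s≰p))) (toℕ<n p)))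
    ... | yes _   | no q≰t  =
      inj₂ (inj₁ (inj₂ (subst (n ∸ m ≤_) (sym (place-above π (≰⇒> q≰t))) (m≤n+m (n ∸ m) (toℕ q)))))
    ... | yes s≤p | yes q≤t = contradiction (innermost p q pq s≤p p<q q≤t) ¬st

band-upper-bound : ∀ {m} (G : OGraph m) → HasEdge G → ∀ n → SsatLE n G (5 * m * n)
band-upper-bound {m} G has-edge n = band n m , band-semisat G has-edge n , band-edges n m

-- The block clique

BothInBlock : ℕ → ℕ → ℕ → ℕ → Set
BothInBlock n K a b = InBlock n K a × InBlock n K b

BothInBlock? : ∀ n K a b → Dec (BothInBlock n K a b)
BothInBlock? n K a b = InBlock? n K a ×-dec InBlock? n K b

BothInBlock-sym : ∀ {n K a b} → BothInBlock n K a b → BothInBlock n K b a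
BothInBlock-sym (a∈B , b∈B) = b∈B , a∈B

module BlockClique (n K : ℕ) = RelationGraph n (BothInBlock? n K) BothInBlock-sym

blockClique : ∀ n K → OGraph n
blockClique n K = BlockClique.graph n K

blockClique-edges : ∀ n K → edges (blockClique n K) ≤ (K + K) * (K + K)
blockClique-edges n K = begin
  edges (blockClique n K)                  ≡⟨ edges≡∑ (blockClique n K) ⟩
  ∑[ i < n ] ∑[ j < n ] [ toℕ i <? toℕ j ×-dec Adjacent? (toℕ i) (toℕ j) ]
                                           ≤⟨ ∑-mono-≤ {n} (λ i → ∑-mono-≤ {n} (λ j → split (toℕ i) (toℕ j))) ⟩
  ∑[ i < n ] ∑[ j < n ] (B i * B j)        ≡⟨ sum-cong-≗ {n} (λ i → *-distribˡ-sum (B i) B) ⟨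
  ∑[ i < n ] (B i * ∑[ j < n ] B j)        ≡⟨ *-distribʳ-sum (∑[ j < n ] B j) B ⟨
  ∑[ i < n ] B i * ∑[ j < n ] B j          ≤⟨ *-mono-≤ (count-block n K) (count-block n K) ⟩
  (K + K) * (K + K)                        ∎
  where
  open ≤-Reasoning
  open BlockClique n K using (Adjacent?)
  B : Fin n → ℕ
  B i = [ InBlock? n K (toℕ i) ]
  split : ∀ a b → [ a <? b ×-dec Adjacent? a b ] ≤ [ InBlock? n K a ] * [ InBlock? n K b ]
  split a b = []-≤-× (proj₂ ∘ proj₂) (a <? b ×-dec Adjacent? a b) (InBlock? n K a) (InBlock? n K b)

LeafEnd : ∀ {m} → OGraph m → Fin m → Fin m → Fin m → Set
LeafEnd G s t w = (w ≡ s × degree G s ≡ 1) ⊎ (w ≡ t × degree G t ≡ 1)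

leaf-end-edge : ∀ {m} (G : OGraph m) {s t p q} → Edge G s t → LeafEnd G s t p → Edge G p q →
  (p ≡ s × q ≡ t) ⊎ (p ≡ t × q ≡ s)
leaf-end-edge G st (inj₁ (refl , deg≡1)) pq = inj₁ (refl , leaf-neighbour-unique G deg≡1 pq st)
leaf-end-edge G st (inj₂ (refl , deg≡1)) pq = inj₂ (refl , leaf-neighbour-unique G deg≡1 pq (Edge-sym G st))

module _ {m} (G : OGraph m) (n : ℕ) where
  private
    K : ℕ
    K = m + m

    m≤K : m ≤ K
    m≤K = m≤m+n m m

    n∸K≤n∸m : n ∸ K ≤ n ∸ m
    n∸K≤n∸m = ∸-monoʳ-≤ n m≤K

  open BlockClique n K using (copy-by-placement)

  -- Edges of G other than st avoid the leaf endpoints of st, so it suffices that all other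
  -- vertices land in a block.
  clique-copy : ∀ {x y : Fin n} {s t : Fin m} (π : Placement s t x y) → Edge G s t → toℕ s < toℕ t →
    ¬ BothInBlock n K (toℕ x) (toℕ y) →
    (∀ w → InBlock n K (Placement.place π (toℕ w)) ⊎ LeafEnd G s t w) → NewCopy G (blockClique n K) x y
  clique-copy {s = s} {t} π st s<t ¬both cover = copy-by-placement G π st ¬both λ p q pq p<q ¬st →
      in-block p (λ p-leaf → ¬st (oriented p<q (leaf-end-edge G st p-leaf pq)))
    , in-block q (λ q-leaf → ¬st (oriented p<q (flip (leaf-end-edge G st q-leaf (Edge-sym G pq)))))
    where
    in-block : ∀ w → ¬ LeafEnd G s t w → InBlock n K (Placement.place π (toℕ w))
    in-block w not-leaf with cover w
    ... | inj₁ w∈B  = w∈B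
    ... | inj₂ leaf = contradiction leaf not-leaf
    flip : ∀ {p q} → (q ≡ s × p ≡ t) ⊎ (q ≡ t × p ≡ s) → (p ≡ s × q ≡ t) ⊎ (p ≡ t × q ≡ s)
    flip (inj₁ (q≡s , p≡t)) = inj₂ (p≡t , q≡s)
    flip (inj₂ (q≡t , p≡s)) = inj₁ (p≡s , q≡t)
    oriented : ∀ {p q} → toℕ p < toℕ q → (p ≡ s × q ≡ t) ⊎ (p ≡ t × q ≡ s) → p ≡ s × q ≡ t
    oriented p<q (inj₁ st)            = st
    oriented p<q (inj₂ (refl , refl)) = contradiction p<q (<-asym s<t)

  private module _ {x y : Fin n} {s t : Fin m} (π : Placement s t x y) where
    open Placement π

    below-in-block : ∀ {w : Fin m} → toℕ w < toℕ s → InBlock n K (place (toℕ w))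
    below-in-block {w} w<s = inj₁ (subst (_< K) (sym (place-below π w<s)) (<-≤-trans (toℕ<n w) m≤K))

    above-in-block : ∀ {w} → toℕ t < w → InBlock n K (place w)
    above-in-block {w} t<w =
      inj₂ (subst (n ∸ K ≤_) (sym (place-above π t<w)) (≤-trans n∸K≤n∸m (m≤n+m (n ∸ m) w)))

  copy-from-first : FirstToLeaf G → ∀ {x y : Fin n} → toℕ x < m → ¬ BothInBlock n K (toℕ x) (toℕ y) →
    NewCopy G (blockClique n K) x y
  copy-from-first (s , t , st , s≡0 , deg-t) {x} {y} x<m ¬both = clique-copy π st s<t ¬both cover
    where
    y-free : K ≤ toℕ y × toℕ y < n ∸ K
    y-free = ¬InBlock (λ y∈B → ¬both (inj₁ (<-≤-trans x<m m≤K) , y∈B))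
    s≤ : ∀ w → toℕ s ≤ w
    s≤ w = subst (_≤ w) (sym s≡0) z≤n
    s<t : toℕ s < toℕ t
    s<t = subst (_< toℕ t) (sym s≡0) (n≢0⇒n>0 λ t≡0 → Edge-irrefl G st (toℕ-injective (trans s≡0 (sym t≡0))))
    π : Placement s t x y
    π = record
      { k = toℕ t ; s<k = s<t ; k≤t = ≤-refl
      ; m≤n = ≤-trans m≤K (≤-trans (proj₁ y-free) (<⇒≤ (toℕ<n y)))
      ; s≤x = s≤ (toℕ x)
      ; gap = <⇒≤ (<-≤-trans (+-mono-<-≤ x<m (≤-trans (m∸n≤m (toℕ t) (toℕ s)) (<⇒≤ (toℕ<n t)))) (proj₁ y-free))
      ; y≤n∸m+t = ≤-trans (<⇒≤ (proj₂ y-free)) (≤-trans n∸K≤n∸m (m≤m+n (n ∸ m) (toℕ t))) }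
    cover : ∀ w → InBlock n K (Placement.place π (toℕ w)) ⊎ LeafEnd G s t w
    cover w with w ≟ᶠ t | <-cmp (toℕ w) (toℕ t)
    ... | yes w≡t | _            = inj₂ (inj₂ (w≡t , deg-t))
    ... | no w≢t  | tri≈ _ w≡t _ = contradiction (toℕ-injective w≡t) w≢t
    ... | no _    | tri> _ _ t<w = inj₁ (above-in-block π t<w)
    ... | no _    | tri< w<t _ _ = inj₁ (inj₁ (subst (_< K) (sym (place-left π (s≤ (toℕ w)) w<t))
                                           (+-mono-<-≤ (toℕ<n w) (≤-trans (m∸n≤m (toℕ x) (toℕ s)) (<⇒≤ x<m)))))

  copy-from-last : LastToLeaf G → ∀ {x y : Fin n} → n ∸ m ≤ toℕ y → ¬ BothInBlock n K (toℕ x) (toℕ y) →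
    NewCopy G (blockClique n K) x y
  copy-from-last (t , s , ts , 1+t≡m , deg-s) {x} {y} n∸m≤y ¬both = clique-copy π st s<t ¬both cover
    where
    x-free : K ≤ toℕ x × toℕ x < n ∸ K
    x-free = ¬InBlock (λ x∈B → ¬both (x∈B , inj₂ (≤-trans n∸K≤n∸m n∸m≤y)))
    K≤n : K ≤ n
    K≤n = ≤-trans (proj₁ x-free) (<⇒≤ (toℕ<n x))
    st : Edge G s t
    st = Edge-sym G ts
    ≤t : ∀ (w : Fin m) → toℕ w ≤ toℕ t
    ≤t w = s≤s⁻¹ (subst (toℕ w <_) (sym 1+t≡m) (toℕ<n w))
    s<t : toℕ s < toℕ t
    s<t = ≤∧≢⇒< (≤t s) (Edge-irrefl G st ∘ toℕ-injective)
    x+m≤n∸m : toℕ x + m ≤ n ∸ m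
    x+m≤n∸m = m+n≤o⇒m≤o∸n (toℕ x + m) (subst (_≤ n) (sym (+-assoc (toℕ x) m m))
                                               (m≤o∸n⇒m+n≤o (toℕ x) K≤n (<⇒≤ (proj₂ x-free))))
    n≡1+n∸m+t : n ≡ suc (n ∸ m + toℕ t)
    n≡1+n∸m+t = begin-equality
      n                      ≡⟨ m∸n+n≡m (≤-trans m≤K K≤n) ⟨
      n ∸ m + m              ≡⟨ cong (n ∸ m +_) 1+t≡m ⟨
      n ∸ m + suc (toℕ t)    ≡⟨ +-suc (n ∸ m) (toℕ t) ⟩
      suc (n ∸ m + toℕ t)    ∎
      where open ≤-Reasoning
    π : Placement s t x y
    π = record
      { k = suc (toℕ s) ; s<k = ≤-refl ; k≤t = s<t
      ; m≤n = ≤-trans m≤K K≤n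
      ; s≤x = ≤-trans (<⇒≤ (toℕ<n s)) (≤-trans m≤K (proj₁ x-free))
      ; gap = ≤-trans (+-monoʳ-≤ (toℕ x) (≤-trans (m∸n≤m (toℕ t) (toℕ s)) (<⇒≤ (toℕ<n t))))
                      (≤-trans x+m≤n∸m n∸m≤y)
      ; y≤n∸m+t = s≤s⁻¹ (subst (toℕ y <_) n≡1+n∸m+t (toℕ<n y)) }
    n∸K≤y∸t : n ∸ K ≤ toℕ y ∸ toℕ t
    n∸K≤y∸t = begin
      n ∸ K              ≡⟨ ∸-+-assoc n m m ⟨
      n ∸ m ∸ m          ≤⟨ ∸-monoʳ-≤ (n ∸ m) (<⇒≤ (toℕ<n t)) ⟩
      n ∸ m ∸ toℕ t      ≤⟨ ∸-monoˡ-≤ (toℕ t) n∸m≤y ⟩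
      toℕ y ∸ toℕ t      ∎
      where open ≤-Reasoning
    cover : ∀ w → InBlock n K (Placement.place π (toℕ w)) ⊎ LeafEnd G s t w
    cover w with w ≟ᶠ s | <-cmp (toℕ w) (toℕ s)
    ... | yes w≡s | _            = inj₂ (inj₁ (w≡s , deg-s))
    ... | no w≢s  | tri≈ _ w≡s _ = contradiction (toℕ-injective w≡s) w≢s
    ... | no _    | tri< w<s _ _ = inj₁ (below-in-block π w<s)
    ... | no _    | tri> _ _ s<w = inj₁ (inj₂ (subst (n ∸ K ≤_) (sym (place-right π s<w (≤t w)))
                                                     (≤-trans n∸K≤y∸t (m≤n+m _ (toℕ w)))))

  copy-from-minedge : HasMinedge G → ∀ {x y : Fin n} → toℕ x < toℕ y → m ≤ toℕ x → toℕ y < n ∸ m →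
    ¬ BothInBlock n K (toℕ x) (toℕ y) → NewCopy G (blockClique n K) x y
  copy-from-minedge (s , t , st , t≡1+s , deg-s , deg-t) {x} {y} x<y m≤x y<n∸m ¬both =
    clique-copy π st s<t ¬both cover
    where
    s<t : toℕ s < toℕ t
    s<t = subst (toℕ s <_) (sym t≡1+s) ≤-refl
    t∸s≡1 : toℕ t ∸ toℕ s ≡ 1
    t∸s≡1 = trans (cong (_∸ toℕ s) t≡1+s) (m+n∸n≡m 1 (toℕ s))
    π : Placement s t x y
    π = record
      { k = toℕ t ; s<k = s<t ; k≤t = ≤-refl
      ; m≤n = ≤-trans m≤x (<⇒≤ (toℕ<n x))
      ; s≤x = ≤-trans (<⇒≤ (toℕ<n s)) m≤x
      ; gap = subst (λ d → toℕ x + d ≤ toℕ y) (sym t∸s≡1) (subst (_≤ toℕ y) (+-comm 1 (toℕ x)) x<y)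
      ; y≤n∸m+t = ≤-trans (<⇒≤ y<n∸m) (m≤m+n (n ∸ m) (toℕ t)) }
    cover : ∀ w → InBlock n K (Placement.place π (toℕ w)) ⊎ LeafEnd G s t w
    cover w with w ≟ᶠ s | w ≟ᶠ t | <-cmp (toℕ w) (toℕ s)
    ... | yes w≡s | _       | _            = inj₂ (inj₁ (w≡s , deg-s))
    ... | no _    | yes w≡t | _            = inj₂ (inj₂ (w≡t , deg-t))
    ... | no w≢s  | no _    | tri≈ _ w≡s _ = contradiction (toℕ-injective w≡s) w≢s
    ... | no _    | no _    | tri< w<s _ _ = inj₁ (below-in-block π w<s)
    ... | no _    | no w≢t  | tri> _ _ s<w =
      inj₁ (above-in-block π (≤∧≢⇒< (subst (_≤ toℕ w) (sym t≡1+s) s<w) (w≢t ∘ toℕ-injective ∘ sym)))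

blockClique-semisat : ∀ {m} (G : OGraph m) → Conditions G → ∀ n → Semisat (blockClique n (m + m)) G
blockClique-semisat {m} G (minedge , first , last) n = BlockClique.semisat-from-< n (m + m) G copy
  where
  copy : ∀ x y → toℕ x < toℕ y → ¬ BothInBlock n (m + m) (toℕ x) (toℕ y) → NewCopy G (blockClique n (m + m)) x y
  copy x y x<y ¬both with toℕ x <? m | n ∸ m ≤? toℕ y
  ... | yes x<m | _         = copy-from-first G n first x<m ¬both
  ... | no _    | yes n∸m≤y = copy-from-last G n last n∸m≤y ¬both
  ... | no x≮m  | no n∸m≰y  = copy-from-minedge G n minedge x<y (≮⇒≥ x≮m) (≰⇒> n∸m≰y) ¬both

blockClique-upper-bound : ∀ {m} (G : OGraph m) → Conditions G → SsatBounded G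
blockClique-upper-bound {m} G conditions =
  (m + m + (m + m)) * (m + m + (m + m)) ,
  λ n → blockClique n (m + m) , blockClique-semisat G conditions n , blockClique-edges n (m + m)

bounded⇒conditions : ∀ {m} (G : OGraph m) → SsatBounded G → Conditions G
bounded⇒conditions G (C , small) = decidable-stable (Conditions? G) λ ¬conditions →
  let (H , sat , e≤C) = small (2 + 5 * C)
      5C+2≤5C = ≤-trans (semisat-lower-bound G ¬conditions (2 + 5 * C) (s≤s (s≤s z≤n)) H sat) (*-monoʳ-≤ 5 e≤C)
  in <-irrefl refl (≤-trans (n≤1+n (suc (5 * C))) 5C+2≤5C)

theorem9 : ∀ {m : ℕ} (G : OGraph m) → HasEdge G →
    (SsatBounded G ⇔ (HasMinedge G × FirstToLeaf G × LastToLeaf G)) ×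
    (¬ (HasMinedge G × FirstToLeaf G × LastToLeaf G) → SsatLinear G)
theorem9 {m} G has-edge =
  mk⇔ (bounded⇒conditions G) (blockClique-upper-bound G) ,
  λ ¬conditions → 5 , 5 * m , 2 , λ n 2≤n →
    semisat-lower-bound G ¬conditions n 2≤n , band-upper-bound G has-edge n
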